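{- For every non-negative integer $n$ and every integer $s$, \[ 2\sum_{k = 1}^{\lceil n/2 \rceil } \binom n{2k - 1}F_{2k + s} = F_{2n + s + 1} - ( - 1)^s F_{n - s - 1},\qquad 2\sum_{k = 1}^{\lceil n/2 \rceil } \binom n{2k - 1}L_{2k + s} = L_{2n + s + 1} + ( - 1)^s L_{n - s - 1}. \]
   Context: The Fibonacci numbers $F_j$ and Lucas numbers $L_j$ are defined for all integers $j$ by $F_0=0$, $F_1=1$, $L_0=2$, $L_1=1$, $F_j=F_{j-1}+F_{j-2}$, $L_j=L_{j-1}+L_{j-2}$, with $F_{ -j}=(-1)^{j-1}F_j$ and $L_{ -j}=(-1)^jL_j$. An empty sum equals $0$. -}

module Defs where

open import Data.Nat as ℕ using (ℕ; zero; suc)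
open import Data.Integer as ℤ using (ℤ; +_; -[1+_]; -1ℤ; ∣_∣)
open import Data.Nat.Combinatorics using (_C_)

fibℕ : ℕ → ℕ
fibℕ zero = 0
fibℕ (suc zero) = 1
fibℕ (suc (suc n)) = fibℕ (suc n) ℕ.+ fibℕ n

lucℕ : ℕ → ℕ
lucℕ zero = 2
lucℕ (suc zero) = 1
lucℕ (suc (suc n)) = lucℕ (suc n) ℕ.+ lucℕ n

sgn : ℕ → ℤ
sgn j = -1ℤ ℤ.^ j

-- Extension to all integers: F_{-j} = (-1)^(j-1) F_j, L_{-j} = (-1)^j L_j
F : ℤ → ℤ
F (+ n) = + fibℕ n
F -[1+ m ] = sgn m ℤ.* + fibℕ (suc m)

L : ℤ → ℤ
L (+ n) = + lucℕ n
L -[1+ m ] = sgn (suc m) ℤ.* + lucℕ (suc m)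

signℤ : ℤ → ℤ
signℤ s = sgn ∣ s ∣

sumFrom1 : ℕ → (ℕ → ℤ) → ℤ
sumFrom1 zero f = + 0
sumFrom1 (suc m) f = sumFrom1 m f ℤ.+ f (suc m)

ceilHalf : ℕ → ℕ
ceilHalf n = suc n ℕ./ 2

-- Write G for F or L; both satisfy G(t+2) = G(t+1) + G(t) on all of ℤ. Because 1 + φ = φ²,
-- Pascal's rule gives Σⱼ C(n,j) G(t+j) = G(t+2n), and because 1 - φ = -1/φ it gives
-- Σⱼ (-1)ʲ C(n,j) G(t+j) = (-1)ⁿ G(t-n); half their difference is the odd part of the sum.
-- With t = s+1, the reflection formulas turn (-1)ⁿ F(s+1-n) into (-1)ˢ F(n-s-1) and
-- (-1)ⁿ L(s+1-n) into -(-1)ˢ L(n-s-1).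
module Submission where

open import Defs
open import Data.Nat as ℕ using (ℕ; zero; suc; _≤_; _<_; z≤n; s≤s)
import Data.Nat.Properties as ℕₚ
open import Data.Nat.Combinatorics using (_C_; k>n⇒nCk≡0; nCk+nC[k+1]≡[n+1]C[k+1])
open import Data.Nat.DivMod using (_%_; m≡m%n+[m/n]*n; m%n<n)
open import Data.Integer as ℤ using (ℤ; +_; -[1+_]; -1ℤ; _+_; _*_; _-_; -_)
import Data.Integer.Properties as ℤₚ
open import Data.Integer.Tactic.RingSolver using (solve-∀)
open import Data.Product using (_×_; _,_)
open import Function using (_∘_)
open import Relation.Binary.PropositionalEquality
  using (_≡_; refl; sym; trans; cong; cong₂; subst; module ≡-Reasoning)

n≤2*ceilHalf : ∀ n → n ≤ 2 ℕ.* ceilHalf n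
n≤2*ceilHalf n = ℕₚ.≤-pred (begin
  suc n                           ≡⟨ m≡m%n+[m/n]*n (suc n) 2 ⟩
  suc n % 2 ℕ.+ ceilHalf n ℕ.* 2  ≤⟨ ℕₚ.+-monoˡ-≤ _ (ℕₚ.≤-pred (m%n<n (suc n) 2)) ⟩
  suc (ceilHalf n ℕ.* 2)          ≡⟨ cong suc (ℕₚ.*-comm (ceilHalf n) 2) ⟩
  suc (2 ℕ.* ceilHalf n)          ∎)
  where open ℕₚ.≤-Reasoning

open ≡-Reasoning

sumBelow : ℕ → (ℕ → ℤ) → ℤ
sumBelow zero    f = + 0
sumBelow (suc N) f = sumBelow N f + f N

sumBelow-cong : ∀ N {f g : ℕ → ℤ} → (∀ j → f j ≡ g j) → sumBelow N f ≡ sumBelow N g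
sumBelow-cong zero    f≗g = refl
sumBelow-cong (suc N) f≗g = cong₂ _+_ (sumBelow-cong N f≗g) (f≗g N)

sumBelow-distrib-+ : ∀ N (f g : ℕ → ℤ) →
  sumBelow N (λ j → f j + g j) ≡ sumBelow N f + sumBelow N g
sumBelow-distrib-+ zero    f g = refl
sumBelow-distrib-+ (suc N) f g =
  trans (cong (_+ (f N + g N)) (sumBelow-distrib-+ N f g))
        (interchange (sumBelow N f) (sumBelow N g) (f N) (g N))
  where
  interchange : ∀ a b c d → (a + b) + (c + d) ≡ (a + c) + (b + d)
  interchange = solve-∀

sumBelow-neg : ∀ N (f : ℕ → ℤ) → sumBelow N (λ j → - f j) ≡ - sumBelow N f
sumBelow-neg zero    f = refl
sumBelow-neg (suc N) f =
  trans (cong (_+ - f N) (sumBelow-neg N f)) (sym (ℤₚ.neg-distrib-+ (sumBelow N f) (f N)))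

sumBelow-head : ∀ N (f : ℕ → ℤ) → sumBelow (suc N) f ≡ f 0 + sumBelow N (f ∘ suc)
sumBelow-head zero    f = ℤₚ.+-comm (+ 0) (f 0)
sumBelow-head (suc N) f =
  trans (cong (_+ f (suc N)) (sumBelow-head N f)) (ℤₚ.+-assoc (f 0) _ _)

sumFrom1-cong : ∀ m {f g : ℕ → ℤ} → (∀ k → f (suc k) ≡ g (suc k)) →
  sumFrom1 m f ≡ sumFrom1 m g
sumFrom1-cong zero    f≗g = refl
sumFrom1-cong (suc m) f≗g = cong₂ _+_ (sumFrom1-cong m f≗g) (f≗g m)

sgn-square : ∀ n → sgn n * sgn n ≡ + 1
sgn-square zero    = refl
sgn-square (suc n) = trans (square-neg (sgn n)) (sgn-square n)
  where
  square-neg : ∀ a → (-1ℤ * a) * (-1ℤ * a) ≡ a * a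
  square-neg = solve-∀

sgn-even : ∀ k → sgn (2 ℕ.* k) ≡ + 1
sgn-even k = trans (sym (ℤₚ.^-*-assoc -1ℤ 2 k)) (ℤₚ.^-zeroˡ k)

signℤ-suc : ∀ t → signℤ (t + + 1) ≡ - signℤ t
signℤ-suc (+ n) rewrite ℕₚ.+-comm n 1 = ℤₚ.-1*i≡-i (sgn n)
signℤ-suc -[1+ zero ]  = refl
signℤ-suc -[1+ suc m ] =
  sym (trans (cong -_ (ℤₚ.-1*i≡-i (sgn (suc m)))) (ℤₚ.neg-involutive (sgn (suc m))))

signℤ-pred : ∀ t → signℤ (t - + 1) ≡ - signℤ t
signℤ-pred t = begin
  signℤ (t - + 1)             ≡⟨ ℤₚ.neg-involutive _ ⟨
  - - signℤ (t - + 1)         ≡⟨ cong -_ (signℤ-suc (t - + 1)) ⟨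
  - signℤ (t - + 1 + + 1)     ≡⟨ cong (-_ ∘ signℤ) (pred-suc t) ⟩
  - signℤ t                   ∎
  where
  pred-suc : ∀ t → t - + 1 + + 1 ≡ t
  pred-suc = solve-∀

signℤ-+ : ∀ n t → signℤ (+ n + t) ≡ sgn n * signℤ t
signℤ-+ zero    t = trans (cong signℤ (ℤₚ.+-identityˡ t)) (sym (ℤₚ.*-identityˡ _))
signℤ-+ (suc n) t = begin
  signℤ (+ 1 + + n + t)       ≡⟨ cong signℤ (suc-outside (+ n) t) ⟩
  signℤ (+ n + t + + 1)       ≡⟨ signℤ-suc (+ n + t) ⟩
  - signℤ (+ n + t)           ≡⟨ cong -_ (signℤ-+ n t) ⟩
  - (sgn n * signℤ t)         ≡⟨ ℤₚ.neg-distribˡ-* (sgn n) (signℤ t) ⟩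
  - sgn n * signℤ t           ≡⟨ cong (_* signℤ t) (ℤₚ.-1*i≡-i (sgn n)) ⟨
  sgn (suc n) * signℤ t       ∎
  where
  suc-outside : ∀ a b → + 1 + a + b ≡ a + b + + 1
  suc-outside = solve-∀

sgn*signℤ-reflect : ∀ n s → sgn n * signℤ (+ n - s - + 1) ≡ - signℤ s
sgn*signℤ-reflect n s = begin
  sgn n * signℤ (+ n - s - + 1)       ≡⟨ cong (sgn n *_) (signℤ-pred (+ n - s)) ⟩
  sgn n * - signℤ (+ n - s)           ≡⟨ cong (λ σ → sgn n * - σ) (signℤ-+ n (- s)) ⟩
  sgn n * - (sgn n * signℤ (- s))     ≡⟨ regroup (sgn n) (signℤ (- s)) ⟩
  - ((sgn n * sgn n) * signℤ (- s))   ≡⟨ cong (λ σ → - (σ * signℤ (- s))) (sgn-square n) ⟩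
  - (+ 1 * signℤ (- s))               ≡⟨ cong -_ (ℤₚ.*-identityˡ _) ⟩
  - signℤ (- s)                       ≡⟨ cong (-_ ∘ sgn) (ℤₚ.∣-i∣≡∣i∣ s) ⟩
  - signℤ s                           ∎
  where
  regroup : ∀ a b → a * - (a * b) ≡ - ((a * a) * b)
  regroup = solve-∀

sumBelow-C-zero : ∀ N (a : ℕ → ℤ) → sumBelow (suc N) (λ j → + (0 C j) * a j) ≡ a 0
sumBelow-C-zero zero    a = trans (ℤₚ.+-identityˡ _) (ℤₚ.*-identityˡ (a 0))
sumBelow-C-zero (suc N) a = begin
  sumBelow (suc N) (λ j → + (0 C j) * a j) + + (0 C suc N) * a (suc N)
    ≡⟨ cong₂ (λ x c → x + + c * a (suc N)) (sumBelow-C-zero N a) (k>n⇒nCk≡0 {0} {suc N} (s≤s z≤n)) ⟩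
  a 0 + + 0
    ≡⟨ ℤₚ.+-identityʳ (a 0) ⟩
  a 0 ∎

sumBelow-C-suc : ∀ N n (a : ℕ → ℤ) →
  sumBelow (suc N) (λ j → + (suc n C j) * a j)
    ≡ sumBelow (suc N) (λ j → + (n C j) * a j) + sumBelow N (λ j → + (n C j) * a (suc j))
sumBelow-C-suc N n a = begin
  sumBelow (suc N) (λ j → + (suc n C j) * a j)
    ≡⟨ sumBelow-head N _ ⟩
  + 1 * a 0 + sumBelow N (λ j → + (suc n C suc j) * a (suc j))
    ≡⟨ cong (_+_ (+ 1 * a 0)) (sumBelow-cong N pascal) ⟩
  + 1 * a 0 + sumBelow N (λ j → + (n C suc j) * a (suc j) + + (n C j) * a (suc j))
    ≡⟨ cong (_+_ (+ 1 * a 0)) (sumBelow-distrib-+ N _ _) ⟩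
  + 1 * a 0 + (sumBelow N (λ j → + (n C suc j) * a (suc j)) + sumBelow N (λ j → + (n C j) * a (suc j)))
    ≡⟨ ℤₚ.+-assoc (+ 1 * a 0) _ _ ⟨
  (+ 1 * a 0 + sumBelow N (λ j → + (n C suc j) * a (suc j))) + sumBelow N (λ j → + (n C j) * a (suc j))
    ≡⟨ cong (_+ sumBelow N (λ j → + (n C j) * a (suc j))) (sumBelow-head N (λ j → + (n C j) * a j)) ⟨
  sumBelow (suc N) (λ j → + (n C j) * a j) + sumBelow N (λ j → + (n C j) * a (suc j)) ∎
  where
  pascal : ∀ j → + (suc n C suc j) * a (suc j) ≡ + (n C suc j) * a (suc j) + + (n C j) * a (suc j)
  pascal j = begin
    + (suc n C suc j) * a (suc j)
      ≡⟨ cong (λ c → + c * a (suc j)) (nCk+nC[k+1]≡[n+1]C[k+1] n j) ⟨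
    + (n C j ℕ.+ n C suc j) * a (suc j)
      ≡⟨ cong (λ c → + c * a (suc j)) (ℕₚ.+-comm (n C j) (n C suc j)) ⟩
    + (n C suc j ℕ.+ n C j) * a (suc j)
      ≡⟨ ℤₚ.*-distribʳ-+ (a (suc j)) (+ (n C suc j)) (+ (n C j)) ⟩
    + (n C suc j) * a (suc j) + + (n C j) * a (suc j) ∎

-- Pairs the terms j = 2k-2, 2k-1: the even ones cancel and the odd ones double.
sumFrom1-odd : ∀ m (c a : ℕ → ℤ) →
  + 2 * sumFrom1 m (λ k → c (2 ℕ.* k ℕ.∸ 1) * a (2 ℕ.* k ℕ.∸ 1))
    ≡ sumBelow (2 ℕ.* m) (λ j → c j * a j) - sumBelow (2 ℕ.* m) (λ j → c j * (sgn j * a j))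
sumFrom1-odd zero    c a = refl
sumFrom1-odd (suc m) c a = begin
  + 2 * (sumFrom1 m odd + c (2 ℕ.* suc m ℕ.∸ 1) * a (2 ℕ.* suc m ℕ.∸ 1))
    ≡⟨ cong (λ i → + 2 * (sumFrom1 m odd + c i * a i)) (cong (ℕ._∸ 1) (ℕₚ.*-suc 2 m)) ⟩
  + 2 * (sumFrom1 m odd + c (suc e) * a (suc e))
    ≡⟨ ℤₚ.*-distribˡ-+ (+ 2) (sumFrom1 m odd) (c (suc e) * a (suc e)) ⟩
  + 2 * sumFrom1 m odd + + 2 * (c (suc e) * a (suc e))
    ≡⟨ cong (λ x → x + + 2 * (c (suc e) * a (suc e))) (sumFrom1-odd m c a) ⟩
  (S - A) + + 2 * (c (suc e) * a (suc e))
    ≡⟨ regroup S A (c e) (a e) (c (suc e)) (a (suc e)) ⟩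
  (S + c e * a e + c (suc e) * a (suc e))
    - (A + c e * (+ 1 * a e) + c (suc e) * ((-1ℤ * + 1) * a (suc e)))
    ≡⟨ cong (λ σ → (S + c e * a e + c (suc e) * a (suc e)) - (A + c e * (σ * a e) + c (suc e) * ((-1ℤ * σ) * a (suc e)))) (sgn-even m) ⟨
  sumBelow (2 ℕ.+ e) (λ j → c j * a j) - sumBelow (2 ℕ.+ e) (λ j → c j * (sgn j * a j))
    ≡⟨ cong (λ N → sumBelow N (λ j → c j * a j) - sumBelow N (λ j → c j * (sgn j * a j)))
            (ℕₚ.*-suc 2 m) ⟨
  sumBelow (2 ℕ.* suc m) (λ j → c j * a j) - sumBelow (2 ℕ.* suc m) (λ j → c j * (sgn j * a j)) ∎
  where
  e = 2 ℕ.* m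
  odd = λ k → c (2 ℕ.* k ℕ.∸ 1) * a (2 ℕ.* k ℕ.∸ 1)
  S = sumBelow e (λ j → c j * a j)
  A = sumBelow e (λ j → c j * (sgn j * a j))
  regroup : ∀ S A c₀ a₀ c₁ a₁ →
    (S - A) + + 2 * (c₁ * a₁)
      ≡ (S + c₀ * a₀ + c₁ * a₁) - (A + c₀ * (+ 1 * a₀) + c₁ * ((-1ℤ * + 1) * a₁))
  regroup = solve-∀

module FibonacciLike (G : ℤ → ℤ) (G-rec : ∀ t → G (t + + 2) ≡ G (t + + 1) + G t) where

  private
    G-shift : ∀ t j → G (t + + suc j) ≡ G (t + + 1 + + j)
    G-shift t j = cong G (sym (ℤₚ.+-assoc t (+ 1) (+ j)))

  binomial-sum : ∀ n N t → n < N →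
    sumBelow N (λ j → + (n C j) * G (t + + j)) ≡ G (t + + (2 ℕ.* n))
  binomial-sum zero    (suc N) t _          = sumBelow-C-zero N (λ j → G (t + + j))
  binomial-sum (suc n) (suc N) t (s≤s n<N) = begin
    sumBelow (suc N) (λ j → + (suc n C j) * G (t + + j))
      ≡⟨ sumBelow-C-suc N n _ ⟩
    S + sumBelow N (λ j → + (n C j) * G (t + + suc j))
      ≡⟨ cong (_+_ S) (sumBelow-cong N (λ j → cong (+ (n C j) *_) (G-shift t j))) ⟩
    S + sumBelow N (λ j → + (n C j) * G (t + + 1 + + j))
      ≡⟨ cong₂ _+_ (binomial-sum n (suc N) t (ℕₚ.m<n⇒m<1+n n<N)) (binomial-sum n N (t + + 1) n<N) ⟩
    G u + G (t + + 1 + + 2n)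
      ≡⟨ cong (λ x → G u + G x) (shuffle t (+ 2n)) ⟨
    G u + G (u + + 1)
      ≡⟨ ℤₚ.+-comm (G u) (G (u + + 1)) ⟩
    G (u + + 1) + G u
      ≡⟨ G-rec u ⟨
    G (u + + 2)
      ≡⟨ cong G (trans (ℤₚ.+-assoc t (+ 2n) (+ 2))
                       (cong (λ i → t + + i) (trans (ℕₚ.+-comm 2n 2) (sym (ℕₚ.*-suc 2 n))))) ⟩
    G (t + + (2 ℕ.* suc n)) ∎
    where
    2n = 2 ℕ.* n
    u = t + + 2n
    S = sumBelow (suc N) (λ j → + (n C j) * G (t + + j))
    shuffle : ∀ t x → t + x + + 1 ≡ t + + 1 + x
    shuffle = solve-∀

  alternating-binomial-sum : ∀ n N t → n < N →
    sumBelow N (λ j → + (n C j) * (sgn j * G (t + + j))) ≡ sgn n * G (t - + n)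
  alternating-binomial-sum zero    (suc N) t _          =
    sumBelow-C-zero N (λ j → sgn j * G (t + + j))
  alternating-binomial-sum (suc n) (suc N) t (s≤s n<N) = begin
    sumBelow (suc N) (λ j → + (suc n C j) * (sgn j * G (t + + j)))
      ≡⟨ sumBelow-C-suc N n _ ⟩
    S + sumBelow N (λ j → + (n C j) * (sgn (suc j) * G (t + + suc j)))
      ≡⟨ cong (_+_ S) (trans (sumBelow-cong N flip) (sumBelow-neg N _)) ⟩
    S - sumBelow N (λ j → + (n C j) * (sgn j * G (t + + 1 + + j)))
      ≡⟨ cong₂ _-_ (alternating-binomial-sum n (suc N) t (ℕₚ.m<n⇒m<1+n n<N))
                   (alternating-binomial-sum n N (t + + 1) n<N) ⟩
    sgn n * G (t - + n) - sgn n * G (t + + 1 - + n)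
      ≡⟨ cong₂ (λ x y → sgn n * G x - sgn n * G y) (shift₁ t (+ n)) (shift₂ t (+ n)) ⟩
    sgn n * G (u + + 1) - sgn n * G (u + + 2)
      ≡⟨ cong (λ x → sgn n * G (u + + 1) - sgn n * x) (G-rec u) ⟩
    sgn n * G (u + + 1) - sgn n * (G (u + + 1) + G u)
      ≡⟨ cancel (sgn n) (G (u + + 1)) (G u) ⟩
    sgn (suc n) * G u ∎
    where
    u = t - + suc n
    S = sumBelow (suc N) (λ j → + (n C j) * (sgn j * G (t + + j)))
    flip : ∀ j → + (n C j) * (sgn (suc j) * G (t + + suc j))
                   ≡ - (+ (n C j) * (sgn j * G (t + + 1 + + j)))
    flip j = trans (cong (λ x → + (n C j) * (sgn (suc j) * x)) (G-shift t j))
                   (pull-sign (+ (n C j)) (sgn j) (G (t + + 1 + + j)))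
      where
      pull-sign : ∀ c σ g → c * ((-1ℤ * σ) * g) ≡ - (c * (σ * g))
      pull-sign = solve-∀
    shift₁ : ∀ t m → t - m ≡ t - (+ 1 + m) + + 1
    shift₁ = solve-∀
    shift₂ : ∀ t m → t + + 1 - m ≡ t - (+ 1 + m) + + 2
    shift₂ = solve-∀
    cancel : ∀ σ g₁ g₀ → σ * g₁ - σ * (g₁ + g₀) ≡ (-1ℤ * σ) * g₀
    cancel = solve-∀

  odd-binomial-sum : ∀ n m t → n < 2 ℕ.* m →
    + 2 * sumFrom1 m (λ k → + (n C (2 ℕ.* k ℕ.∸ 1)) * G (t + + (2 ℕ.* k ℕ.∸ 1)))
      ≡ G (t + + (2 ℕ.* n)) - sgn n * G (t - + n)
  odd-binomial-sum n m t n<2m =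
    trans (sumFrom1-odd m (λ j → + (n C j)) (λ j → G (t + + j)))
          (cong₂ _-_ (binomial-sum n (2 ℕ.* m) t n<2m)
                     (alternating-binomial-sum n (2 ℕ.* m) t n<2m))

  -- 2⌈n/2⌉ may equal n, so one vanishing term C(n, 2⌈n/2⌉+1) is added to reach n < 2m.
  ceilHalf-odd-binomial-sum : ∀ n s →
    + 2 * sumFrom1 (ceilHalf n) (λ k → + (n C (2 ℕ.* k ℕ.∸ 1)) * G (+ (2 ℕ.* k) + s))
      ≡ G (+ (2 ℕ.* n) + s + + 1) - sgn n * G (s + + 1 - + n)
  ceilHalf-odd-binomial-sum n s = begin
    + 2 * sumFrom1 c f
      ≡⟨ cong (_*_ (+ 2)) (ℤₚ.+-identityʳ (sumFrom1 c f)) ⟨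
    + 2 * (sumFrom1 c f + + 0)
      ≡⟨ cong (λ x → + 2 * (sumFrom1 c f + + x * G (+ (2 ℕ.* suc c) + s))) (k>n⇒nCk≡0 n<top) ⟨
    + 2 * sumFrom1 (suc c) f
      ≡⟨ cong (_*_ (+ 2)) (sumFrom1-cong (suc c) λ k →
           cong (λ x → + (n C (2 ℕ.* suc k ℕ.∸ 1)) * G x) (reindex s (+ (2 ℕ.* suc k ℕ.∸ 1)))) ⟩
    + 2 * sumFrom1 (suc c) (λ k → + (n C (2 ℕ.* k ℕ.∸ 1)) * G (s + + 1 + + (2 ℕ.* k ℕ.∸ 1)))
      ≡⟨ odd-binomial-sum n (suc c) (s + + 1) n<2[1+c] ⟩
    G (s + + 1 + + (2 ℕ.* n)) - sgn n * G (s + + 1 - + n)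
      ≡⟨ cong (λ x → G x - sgn n * G (s + + 1 - + n)) (rotate s (+ (2 ℕ.* n))) ⟨
    G (+ (2 ℕ.* n) + s + + 1) - sgn n * G (s + + 1 - + n) ∎
    where
    c = ceilHalf n
    f = λ k → + (n C (2 ℕ.* k ℕ.∸ 1)) * G (+ (2 ℕ.* k) + s)
    n<top : n < 2 ℕ.* suc c ℕ.∸ 1
    n<top = subst (n <_) (sym (cong (ℕ._∸ 1) (ℕₚ.*-suc 2 c))) (s≤s (n≤2*ceilHalf n))
    n<2[1+c] : n < 2 ℕ.* suc c
    n<2[1+c] = subst (n <_) (sym (ℕₚ.*-suc 2 c)) (ℕₚ.m≤n⇒m≤1+n (s≤s (n≤2*ceilHalf n)))
    reindex : ∀ s x → + 1 + x + s ≡ s + + 1 + x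
    reindex = solve-∀
    rotate : ∀ s x → x + s + + 1 ≡ s + + 1 + x
    rotate = solve-∀

-- The recurrence at negative indices, where the terms carry alternating signs.
signed-recurrence : ∀ σ a b → σ * a ≡ (-1ℤ * σ) * b + (-1ℤ * (-1ℤ * σ)) * (b + a)
signed-recurrence = solve-∀

F-rec : ∀ t → F (t + + 2) ≡ F (t + + 1) + F t
F-rec (+ n) rewrite ℕₚ.+-comm n 2 | ℕₚ.+-comm n 1 = refl
F-rec -[1+ 0 ]           = refl
F-rec -[1+ 1 ]           = refl
F-rec -[1+ suc (suc m) ] = signed-recurrence (sgn m) (+ fibℕ (suc m)) (+ fibℕ (suc (suc m)))

L-rec : ∀ t → L (t + + 2) ≡ L (t + + 1) + L t
L-rec (+ n) rewrite ℕₚ.+-comm n 2 | ℕₚ.+-comm n 1 = refl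
L-rec -[1+ 0 ]           = refl
L-rec -[1+ 1 ]           = refl
L-rec -[1+ suc (suc m) ] = signed-recurrence (sgn (suc m)) (+ lucℕ (suc m)) (+ lucℕ (suc (suc m)))

F-neg : ∀ t → F (- t) ≡ - (signℤ t * F t)
F-neg (+ zero)  = refl
F-neg (+ suc m) = pull-sign (sgn m) (+ fibℕ (suc m))
  where
  pull-sign : ∀ σ a → σ * a ≡ - ((-1ℤ * σ) * a)
  pull-sign = solve-∀
F-neg -[1+ m ]  = begin
  + fibℕ (suc m)                                     ≡⟨ ℤₚ.*-identityˡ _ ⟨
  + 1 * + fibℕ (suc m)                               ≡⟨ cong (_* + fibℕ (suc m)) (sgn-square m) ⟨
  (sgn m * sgn m) * + fibℕ (suc m)                   ≡⟨ regroup (sgn m) (+ fibℕ (suc m)) ⟩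
  - ((-1ℤ * sgn m) * (sgn m * + fibℕ (suc m)))       ∎
  where
  regroup : ∀ σ a → (σ * σ) * a ≡ - ((-1ℤ * σ) * (σ * a))
  regroup = solve-∀

L-neg : ∀ t → L (- t) ≡ signℤ t * L t
L-neg (+ zero)  = refl
L-neg (+ suc m) = refl
L-neg -[1+ m ]  = begin
  + lucℕ (suc m)                                     ≡⟨ ℤₚ.*-identityˡ _ ⟨
  + 1 * + lucℕ (suc m)                               ≡⟨ cong (_* + lucℕ (suc m)) (sgn-square (suc m)) ⟨
  (sgn (suc m) * sgn (suc m)) * + lucℕ (suc m)       ≡⟨ ℤₚ.*-assoc (sgn (suc m)) _ _ ⟩
  sgn (suc m) * (sgn (suc m) * + lucℕ (suc m))       ∎

reflect-index : ∀ s m → s + + 1 - m ≡ - (m - s - + 1)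
reflect-index = solve-∀

F-reflect : ∀ n s → sgn n * F (s + + 1 - + n) ≡ signℤ s * F (+ n - s - + 1)
F-reflect n s = begin
  sgn n * F (s + + 1 - + n)          ≡⟨ cong (λ x → sgn n * F x) (reflect-index s (+ n)) ⟩
  sgn n * F (- u)                    ≡⟨ cong (_*_ (sgn n)) (F-neg u) ⟩
  sgn n * - (signℤ u * F u)          ≡⟨ regroup (sgn n) (signℤ u) (F u) ⟩
  - (sgn n * signℤ u) * F u          ≡⟨ cong (λ σ → - σ * F u) (sgn*signℤ-reflect n s) ⟩
  - - signℤ s * F u                  ≡⟨ cong (_* F u) (ℤₚ.neg-involutive (signℤ s)) ⟩
  signℤ s * F u                      ∎
  where
  u = + n - s - + 1
  regroup : ∀ a b x → a * - (b * x) ≡ - (a * b) * x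
  regroup = solve-∀

L-reflect : ∀ n s → sgn n * L (s + + 1 - + n) ≡ - (signℤ s * L (+ n - s - + 1))
L-reflect n s = begin
  sgn n * L (s + + 1 - + n)          ≡⟨ cong (λ x → sgn n * L x) (reflect-index s (+ n)) ⟩
  sgn n * L (- u)                    ≡⟨ cong (_*_ (sgn n)) (L-neg u) ⟩
  sgn n * (signℤ u * L u)            ≡⟨ ℤₚ.*-assoc (sgn n) (signℤ u) (L u) ⟨
  (sgn n * signℤ u) * L u            ≡⟨ cong (_* L u) (sgn*signℤ-reflect n s) ⟩
  - signℤ s * L u                    ≡⟨ ℤₚ.neg-distribˡ-* (signℤ s) (L u) ⟨
  - (signℤ s * L u)                  ∎
  where
  u = + n - s - + 1

module Fib = FibonacciLike F F-rec
module Luc = FibonacciLike L L-rec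

theorem15 : (n : ℕ) (s : ℤ) →
    ((+ 2) ℤ.* sumFrom1 (ceilHalf n) (λ k → + (n C (2 ℕ.* k ℕ.∸ 1)) ℤ.* F (+ (2 ℕ.* k) ℤ.+ s))
      ≡ F ((+ (2 ℕ.* n)) ℤ.+ s ℤ.+ + 1) ℤ.- signℤ s ℤ.* F ((+ n) ℤ.- s ℤ.- + 1))
    × ((+ 2) ℤ.* sumFrom1 (ceilHalf n) (λ k → + (n C (2 ℕ.* k ℕ.∸ 1)) ℤ.* L (+ (2 ℕ.* k) ℤ.+ s))
      ≡ L ((+ (2 ℕ.* n)) ℤ.+ s ℤ.+ + 1) ℤ.+ signℤ s ℤ.* L ((+ n) ℤ.- s ℤ.- + 1))
theorem15 n s =
    trans (Fib.ceilHalf-odd-binomial-sum n s) (cong (λ y → F X - y) (F-reflect n s))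
  , trans (Luc.ceilHalf-odd-binomial-sum n s)
          (trans (cong (λ y → L X - y) (L-reflect n s))
                 (cong (_+_ (L X)) (ℤₚ.neg-involutive (signℤ s * L (+ n - s - + 1)))))
  where
  X = + (2 ℕ.* n) + s + + 1
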